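{- Let $G$ and $H$ be connected graphs, each with at least two vertices. Let $(V_1,V_2)$ be a partition of $G$, and let $(V_1',V_2')$ be the partition of $G\square H$ given by $V_i'=\{(v,h): v\in V_i,\ h\in V(H)\}$ for $i=1,2$. Then for $i=1,2$, $$\min_{v'\in V_i'} q^i_{G\square H}(v')>\min_{v\in V_i} q^i_G(v),$$ where $q^i_{G\square H}$ is computed with respect to $(V_1',V_2')$ in $G\square H$ and $q^i_G$ with respect to $(V_1,V_2)$ in $G$.
   Context: All graphs are finite, simple and undirected. For a vertex $v$ of a graph $X$, $N_X[v]$ is its closed neighbourhood and $d_X[v]=|N_X[v]|$. A partition of $X$ is a pair $(V_1,V_2)$ of nonempty disjoint sets with union $V(X)$; for $v\in V_i$, $q^i_X(v)=|N_X[v]\cap V_i|/d_X[v]$. The cartesian product $G\square H$ has vertex set $V(G)\times V(H)$, with $(g_1,h_1)$ adjacent to $(g_2,h_2)$ iff either $g_1=g_2$ and $h_1h_2\in E(H)$, or $h_1=h_2$ and $g_1g_2\in E(G)$. -}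

module Defs where

open import Data.Bool using (Bool; true; false; _∧_; _∨_; if_then_else_)
open import Data.Nat using (ℕ; zero; suc; _+_; _*_; _≤_; _<_; z≤n; s≤s; NonZero; >-nonZero)
open import Data.Nat.Properties using (m≤n+m; ≤-trans; ≤-refl)
open import Data.Fin using (Fin; zero; suc; remQuot)
open import Data.Fin.Properties using (_≟_)
open import Data.Product using (Σ; _×_; _,_; ∃; proj₁; proj₂)
open import Data.Integer using (+_)
open import Data.Rational using (ℚ; _/_)
open import Relation.Nullary using (¬_; does)
open import Relation.Binary.PropositionalEquality using (_≡_; refl)

record Graph : Set where
  field
    n   : ℕ
    adj : Fin n → Fin n → Bool
open Graph public

IsSimple : Graph → Set
IsSimple G = (∀ u v → adj G u v ≡ adj G v u) × (∀ v → adj G v v ≡ false)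

data Walk (G : Graph) : Fin (n G) → Fin (n G) → Set where
  here : ∀ {u} → Walk G u u
  step : ∀ {u v w} → adj G u v ≡ true → Walk G v w → Walk G u w

Connected : Graph → Set
Connected G = ∀ u v → Walk G u v

count : ∀ k → (Fin k → Bool) → ℕ
count zero    f = 0
count (suc k) f = (if f zero then 1 else 0) + count k (λ i → f (suc i))

count-pos : ∀ {k} (f : Fin k → Bool) (v : Fin k) → f v ≡ true → 0 < count k f
count-pos {suc k} f zero eq with f zero
... | true = s≤s z≤n
count-pos {suc k} f (suc v) eq =
  ≤-trans (count-pos (λ i → f (suc i)) v eq) (m≤n+m _ (if f zero then 1 else 0))

closedNb : (G : Graph) → Fin (n G) → Fin (n G) → Bool
closedNb G v u = does (v ≟ u) ∨ adj G v u

closedNb-self : (G : Graph) (v : Fin (n G)) → closedNb G v v ≡ true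
closedNb-self G v with v ≟ v
... | Relation.Nullary.yes _ = refl
... | Relation.Nullary.no ¬p = Data.Empty.⊥-elim (¬p refl)
  where import Data.Empty

closedDeg : (G : Graph) → Fin (n G) → ℕ
closedDeg G v = count (n G) (closedNb G v)

closedDeg-nonZero : (G : Graph) (v : Fin (n G)) → NonZero (closedDeg G v)
closedDeg-nonZero G v = >-nonZero (count-pos (closedNb G v) v (closedNb-self G v))

-- A partition (V_1,V_2): side v ≡ true means v ∈ V_1, side v ≡ false means v ∈ V_2.
-- Both parts are required to be nonempty.
IsPartition : (G : Graph) → (Fin (n G) → Bool) → Set
IsPartition G side = (∃ λ v → side v ≡ true) × (∃ λ v → side v ≡ false)

sameSide : Bool → Bool → Bool
sameSide true  true  = true
sameSide false false = true
sameSide _     _     = false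

q : (G : Graph) → (Fin (n G) → Bool) → Fin (n G) → ℚ
q G side v = _/_ (+ count (n G) (λ u → closedNb G v u ∧ sameSide (side u) (side v)))
                 (closedDeg G v) {{closedDeg-nonZero G v}}

coord : (G H : Graph) → Fin (n G * n H) → Fin (n G) × Fin (n H)
coord G H x = remQuot {n G} (n H) x

_□_ : Graph → Graph → Graph
G □ H = record
  { n   = n G * n H
  ; adj = λ x y → let gx = proj₁ (coord G H x) ; hx = proj₂ (coord G H x)
                      gy = proj₁ (coord G H y) ; hy = proj₂ (coord G H y)
                  in (does (gx ≟ gy) ∧ adj H hx hy) ∨ (does (hx ≟ hy) ∧ adj G gx gy)
  }

liftSide : (G H : Graph) → (Fin (n G) → Bool) → Fin (n (G □ H)) → Bool
liftSide G H side x = side (proj₁ (coord G H x))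

IsMinOn : {k : ℕ} → (Fin k → Bool) → Bool → (Fin k → ℚ) → ℚ → Set
IsMinOn side b f m = (∃ λ v → side v ≡ b × f v ≡ m) × (∀ v → side v ≡ b → m Data.Rational.≤ f v)

-- In G □ H the closed neighbourhood of (g , h) is the layer N_G[g] × {h} together with the
-- fibre {g} × N_H(h). The fibre is nonempty and lies in the part of (g , h); the layer
-- contributes exactly the same-part and cross-part counts a, c of g. Hence
-- q(g , h) = (a + e) / (a + c + e) with e ≥ 1, which exceeds q(g) = a / (a + c) when c > 0 and
-- equals 1 when c = 0. In the latter case connectivity of G yields a vertex of the same part
-- with a neighbour in the other part, and its q is below 1.
module Submission where

open import Defs
open import Data.Bool using (Bool)
open import Data.Nat using (_≤_)
open import Data.Product using (_×_)
open import Data.Rational using (ℚ; _<_)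
open import Data.Fin using (Fin)

open import Data.Bool as Bool using (true; false; _∧_; _∨_; not; if_then_else_)
open import Data.Bool.Properties using (∧-assoc; ∧-zeroʳ; ∨-zeroʳ; ∨-identityʳ)
open import Data.Nat as ℕ using (ℕ; zero; suc; NonZero; _+_; _*_; z≤n; s≤s; z<s)
open import Data.Nat.Properties as ℕ using (+-0-monoid; module ≤-Reasoning)
open import Algebra.Properties.Monoid.Sum +-0-monoid using (sum-syntax; sum-cong-≗)
open import Data.Integer as ℤ using (+<+)
open import Data.Integer.Properties using (pos-*)
open import Data.Rational using (_/_)
open import Data.Rational.Properties using (toℚᵘ-cancel-<; toℚᵘ-fromℚᵘ; ≤-<-trans)
open import Data.Rational.Unnormalised using (mkℚᵘ; *<*)
open import Data.Rational.Unnormalised.Properties using (<-respˡ-≃; <-respʳ-≃; ≃-sym)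
open import Data.Fin using (zero; suc; _↑ˡ_; _↑ʳ_; combine; remQuot; punchIn)
open import Data.Fin.Properties using (_≟_; remQuot-combine; combine-remQuot; punchInᵢ≢i)
open import Data.Product using (∃; ∃₂; _,_; proj₁; proj₂; uncurry)
open import Function using (_∘_; mk⇔)
open import Relation.Nullary using (yes; no; does; _×-dec_; contradiction)
open import Relation.Nullary.Decidable using (does-⇔; dec-true)
open import Relation.Binary.PropositionalEquality
  using (_≡_; _≢_; _≗_; refl; sym; trans; cong; cong₂; subst; subst₂; module ≡-Reasoning)

+p/d<+r/e : ∀ p d r e .{{_ : NonZero d}} .{{_ : NonZero e}} →
            p * e ℕ.< r * d → ℤ.+ p / d < ℤ.+ r / e
+p/d<+r/e p (suc d) r (suc e) pe<rd =
  toℚᵘ-cancel-< (<-respʳ-≃ (≃-sym (toℚᵘ-fromℚᵘ (mkℚᵘ (ℤ.+ r) e)))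
                (<-respˡ-≃ (≃-sym (toℚᵘ-fromℚᵘ (mkℚᵘ (ℤ.+ p) d)))
                  (*<* (subst₂ ℤ._<_ (pos-* p (suc e)) (pos-* r (suc d)) (+<+ pe<rd)))))

a*[A+c]<A*[a+c] : ∀ {a A} c → a ℕ.< A → 0 ℕ.< c → a * (A + c) ℕ.< A * (a + c)
a*[A+c]<A*[a+c] {a} {A} c a<A 0<c = begin-strict
  a * (A + c)    ≡⟨ ℕ.*-distribˡ-+ a A c ⟩
  a * A + a * c  <⟨ ℕ.+-monoʳ-< (a * A) (ℕ.*-monoˡ-< c {{ℕ.>-nonZero 0<c}} a<A) ⟩
  a * A + A * c  ≡⟨ cong (_+ A * c) (ℕ.*-comm a A) ⟩
  A * a + A * c  ≡⟨ ℕ.*-distribˡ-+ A a c ⟨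
  A * (a + c)    ∎
  where open ≤-Reasoning

a*A<A*[a+c] : ∀ {a A c} → 0 ℕ.< A → 0 ℕ.< c → a * A ℕ.< A * (a + c)
a*A<A*[a+c] {a} {A} {c} 0<A 0<c = begin-strict
  a * A          ≡⟨ ℕ.*-comm a A ⟩
  A * a          <⟨ ℕ.m<m+n (A * a) (ℕ.>-nonZero⁻¹ (A * c) {{A*c≢0}}) ⟩
  A * a + A * c  ≡⟨ ℕ.*-distribˡ-+ A a c ⟨
  A * (a + c)    ∎
  where
  open ≤-Reasoning
  A*c≢0 = ℕ.m*n≢0 A c {{ℕ.>-nonZero 0<A}} {{ℕ.>-nonZero 0<c}}

count-cong : ∀ {k} {f g : Fin k → Bool} → f ≗ g → count k f ≡ count k g
count-cong {zero}  f≗g = refl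
count-cong {suc k} f≗g =
  cong₂ (λ b c → (if b then 1 else 0) + c) (f≗g zero) (count-cong (f≗g ∘ suc))

count-sum : ∀ {k} (f : Fin k → Bool) → count k f ≡ ∑[ i < k ] (if f i then 1 else 0)
count-sum {zero}  f = refl
count-sum {suc k} f = cong ((if f zero then 1 else 0) +_) (count-sum (f ∘ suc))

count-∨ : ∀ {k} (f g : Fin k → Bool) → (∀ i → f i ≡ true → g i ≡ false) →
          count k (λ i → f i ∨ g i) ≡ count k f + count k g
count-∨ {zero}  f g disjoint = refl
count-∨ {suc k} f g disjoint
  with f zero in f₀ | g zero in g₀ | count-∨ (f ∘ suc) (g ∘ suc) (disjoint ∘ suc)
... | true  | true  | _    = contradiction (trans (sym g₀) (disjoint zero f₀)) λ ()
... | true  | false | rest = cong suc rest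
... | false | true  | rest = trans (cong suc rest) (sym (ℕ.+-suc _ _))
... | false | false | rest = rest

count-split : ∀ {k} (f p : Fin k → Bool) →
              count k f ≡ count k (λ i → f i ∧ p i) + count k (λ i → f i ∧ not (p i))
count-split {zero}  f p = refl
count-split {suc k} f p with f zero | p zero | count-split (f ∘ suc) (p ∘ suc)
... | true  | true  | rest = cong suc rest
... | true  | false | rest = trans (cong suc rest) (sym (ℕ.+-suc _ _))
... | false | _     | rest = rest

count-++ : ∀ m {n} (f : Fin (m + n) → Bool) →
           count (m + n) f ≡ count m (λ i → f (i ↑ˡ n)) + count n (λ j → f (m ↑ʳ j))
count-++ zero    f = refl
count-++ (suc m) f = trans (cong ((if f zero then 1 else 0) +_) (count-++ m (f ∘ suc)))
                           (sym (ℕ.+-assoc (if f zero then 1 else 0) _ _))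

count-* : ∀ m {n} (f : Fin (m * n) → Bool) →
          count (m * n) f ≡ ∑[ i < m ] count n (λ j → f (combine i j))
count-* zero        f = refl
count-* (suc m) {n} f = trans (count-++ n f)
  (cong (count n (λ j → f (j ↑ˡ m * n)) +_) (count-* m (λ y → f (n ↑ʳ y))))

count-const-false : ∀ k → count k (λ _ → false) ≡ 0
count-const-false zero    = refl
count-const-false (suc k) = count-const-false k

count-≟∧ : ∀ {k} (h : Fin k) c → count k (λ j → does (h ≟ j) ∧ c) ≡ (if c then 1 else 0)
count-≟∧ {suc k} zero    c = trans (cong ((if c then 1 else 0) +_) (count-const-false k))
                                   (ℕ.+-identityʳ _)
count-≟∧ {suc k} (suc h) c = count-≟∧ h c

count-layer : ∀ m {n} (h : Fin n) (P : Fin m → Bool) →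
              count (m * n) (λ y → does (h ≟ proj₂ (remQuot {m} n y)) ∧ P (proj₁ (remQuot {m} n y)))
              ≡ count m P
count-layer m {n} h P = begin
  count (m * n) (λ y → layer (remQuot {m} n y))
    ≡⟨ count-* m _ ⟩
  ∑[ i < m ] count n (λ j → layer (remQuot {m} n (combine i j)))
    ≡⟨ sum-cong-≗ (λ i → count-cong (λ j → cong layer (remQuot-combine i j))) ⟩
  ∑[ i < m ] count n (λ j → does (h ≟ j) ∧ P i)
    ≡⟨ sum-cong-≗ (λ i → count-≟∧ h (P i)) ⟩
  ∑[ i < m ] (if P i then 1 else 0)
    ≡⟨ count-sum P ⟨
  count m P
    ∎
  where
  open ≡-Reasoning
  layer : Fin m × Fin n → Bool
  layer (i , j) = does (h ≟ j) ∧ P i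

sameSide-≢ : ∀ {b c} → b ≢ c → sameSide b c ≡ false
sameSide-≢ {true}  {true}  b≢c = contradiction refl b≢c
sameSide-≢ {true}  {false} b≢c = refl
sameSide-≢ {false} {true}  b≢c = refl
sameSide-≢ {false} {false} b≢c = contradiction refl b≢c

sameSide-refl : ∀ b → sameSide b b ≡ true
sameSide-refl true  = refl
sameSide-refl false = refl

sameNb crossNb : (G : Graph) → (Fin (n G) → Bool) → Fin (n G) → Fin (n G) → Bool
sameNb  G side v u = closedNb G v u ∧ sameSide (side u) (side v)
crossNb G side v u = closedNb G v u ∧ not (sameSide (side u) (side v))

sameCount crossCount : (G : Graph) → (Fin (n G) → Bool) → Fin (n G) → ℕ
sameCount  G side v = count (n G) (sameNb G side v)
crossCount G side v = count (n G) (crossNb G side v)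

closedDeg-split : ∀ G side v → closedDeg G v ≡ sameCount G side v + crossCount G side v
closedDeg-split G side v = count-split (closedNb G v) (λ u → sameSide (side u) (side v))

q<q : ∀ G side v G′ side′ v′ →
      sameCount G side v * closedDeg G′ v′ ℕ.< sameCount G′ side′ v′ * closedDeg G v →
      q G side v < q G′ side′ v′
q<q G side v G′ side′ v′ =
  +p/d<+r/e (sameCount G side v) (closedDeg G v) (sameCount G′ side′ v′) (closedDeg G′ v′)
            {{closedDeg-nonZero G v}} {{closedDeg-nonZero G′ v′}}

ExitEdge : (G : Graph) → (Fin (n G) → Bool) → Bool → Set
ExitEdge G side b = ∃₂ λ w u → side w ≡ b × side u ≢ b × adj G w u ≡ true

walk-exitEdge : ∀ {G side b u v} → Walk G u v → side u ≡ b → side v ≢ b → ExitEdge G side b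
walk-exitEdge here su≡b sv≢b = contradiction su≡b sv≢b
walk-exitEdge {side = side} {b} (step {v = u′} uu′ walk) su≡b sv≢b with side u′ Bool.≟ b
... | yes su′≡b = walk-exitEdge walk su′≡b sv≢b
... | no  su′≢b = _ , u′ , su≡b , su′≢b , uu′

connected⇒exitEdge : ∀ {G side} → Connected G → IsPartition G side → ∀ b → ExitEdge G side b
connected⇒exitEdge conn ((v₁ , s₁) , (v₂ , s₂)) true  =
  walk-exitEdge (conn v₁ v₂) s₁ (λ s₂′ → contradiction (trans (sym s₂) s₂′) λ ())
connected⇒exitEdge conn ((v₁ , s₁) , (v₂ , s₂)) false =
  walk-exitEdge (conn v₂ v₁) s₂ (λ s₁′ → contradiction (trans (sym s₁) s₁′) λ ())

exitEdge⇒crossCount-pos : ∀ {G side b} → ((w , _) : ExitEdge G side b) → 0 ℕ.< crossCount G side w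
exitEdge⇒crossCount-pos {G} {side} (w , u , sw≡b , su≢b , wu) = count-pos _ u
  (cong₂ _∧_ (trans (cong (does (w ≟ u) ∨_) wu) (∨-zeroʳ _))
             (cong not (sameSide-≢ (λ su≡sw → su≢b (trans su≡sw sw≡b)))))

∃-≢ : ∀ {k} → 2 ≤ k → (i : Fin k) → ∃ λ j → j ≢ i
∃-≢ {suc zero}    (s≤s ()) _
∃-≢ {suc (suc k)} _        i = punchIn i zero , punchInᵢ≢i i zero

connected⇒neighbour : ∀ {H} → Connected H → 2 ≤ n H → ∀ h → ∃ λ h′ → adj H h h′ ≡ true
connected⇒neighbour {H} conn 2≤n h with ∃-≢ 2≤n h
... | h′ , h′≢h = first-step (conn h h′) (h′≢h ∘ sym)
  where
  first-step : ∀ {u v} → Walk H u v → u ≢ v → ∃ λ w → adj H u w ≡ true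
  first-step here          u≢u = contradiction refl u≢u
  first-step (step uw _)   _   = _ , uw

coord-injective : ∀ G H {x y : Fin (n (G □ H))} → coord G H x ≡ coord G H y → x ≡ y
coord-injective G H {x} {y} eq = begin
  x                             ≡⟨ combine-remQuot {n G} (n H) x ⟨
  uncurry combine (coord G H x) ≡⟨ cong (uncurry combine) eq ⟩
  uncurry combine (coord G H y) ≡⟨ combine-remQuot {n G} (n H) y ⟩
  y                             ∎
  where open ≡-Reasoning

does-≟-coord : ∀ G H (x y : Fin (n (G □ H))) →
               does (x ≟ y) ≡ does (proj₁ (coord G H x) ≟ proj₁ (coord G H y))
                            ∧ does (proj₂ (coord G H x) ≟ proj₂ (coord G H y))
does-≟-coord G H x y = does-⇔
  (mk⇔ (λ { refl → refl , refl }) (λ (eq₁ , eq₂) → coord-injective G H (cong₂ _,_ eq₁ eq₂)))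
  (x ≟ y)
  ((proj₁ (coord G H x) ≟ proj₁ (coord G H y)) ×-dec (proj₂ (coord G H x) ≟ proj₂ (coord G H y)))

∨-∧-distrib-⊆ : ∀ l f s → (f ≡ true → s ≡ true) → (l ∨ f) ∧ s ≡ (l ∧ s) ∨ f
∨-∧-distrib-⊆ l     false s     _   = trans (cong (_∧ s) (∨-identityʳ l)) (sym (∨-identityʳ (l ∧ s)))
∨-∧-distrib-⊆ true  true  true  _   = refl
∨-∧-distrib-⊆ false true  true  _   = refl
∨-∧-distrib-⊆ _     true  false f⊆s = contradiction (f⊆s refl) λ ()

∨-∧-not-⊆ : ∀ l f s → (f ≡ true → s ≡ true) → (l ∨ f) ∧ not s ≡ l ∧ not s
∨-∧-not-⊆ l     false s     _   = cong (_∧ not s) (∨-identityʳ l)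
∨-∧-not-⊆ true  true  true  _   = refl
∨-∧-not-⊆ false true  true  _   = refl
∨-∧-not-⊆ _     true  false f⊆s = contradiction (f⊆s refl) λ ()

module ProductVertex (G H : Graph) (side : Fin (n G) → Bool) (x : Fin (n (G □ H))) where

  side′ : Fin (n (G □ H)) → Bool
  side′ = liftSide G H side

  g : Fin (n G)
  g = proj₁ (coord G H x)

  h : Fin (n H)
  h = proj₂ (coord G H x)

  layer : (Fin (n G) → Bool) → Fin (n (G □ H)) → Bool
  layer P y = does (h ≟ proj₂ (coord G H y)) ∧ P (proj₁ (coord G H y))

  fibre : Fin (n (G □ H)) → Bool
  fibre y = does (g ≟ proj₁ (coord G H y)) ∧ adj H h (proj₂ (coord G H y))

  closedNb-□ : ∀ y → closedNb (G □ H) x y ≡ layer (closedNb G g) y ∨ fibre y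
  closedNb-□ y = trans (cong (_∨ (e ∧ aH ∨ f ∧ aG)) (does-≟-coord G H x y)) (regroup e f aG aH)
    where
    e  = does (g ≟ proj₁ (coord G H y))
    f  = does (h ≟ proj₂ (coord G H y))
    aG = adj G g (proj₁ (coord G H y))
    aH = adj H h (proj₂ (coord G H y))
    regroup : ∀ e f aG aH → (e ∧ f) ∨ ((e ∧ aH) ∨ (f ∧ aG)) ≡ (f ∧ (e ∨ aG)) ∨ (e ∧ aH)
    regroup true  true  aG aH = refl
    regroup true  false aG aH = ∨-identityʳ aH
    regroup false true  aG aH = sym (∨-identityʳ aG)
    regroup false false aG aH = refl

  fibre⊆samePart : ∀ y → fibre y ≡ true → sameSide (side′ y) (side g) ≡ true
  fibre⊆samePart y fy with g ≟ proj₁ (coord G H y)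
  ... | yes g≡gy = subst (λ u → sameSide (side u) (side g) ≡ true) g≡gy (sameSide-refl (side g))
  ... | no  _    = contradiction fy λ ()

  layer∩fibre : (∀ v → adj H v v ≡ false) → ∀ P y → layer P y ≡ true → fibre y ≡ false
  layer∩fibre loopless P y ly with h ≟ proj₂ (coord G H y)
  ... | yes h≡hy = subst (λ v → e ∧ adj H h v ≡ false) h≡hy
                         (trans (cong (e ∧_) (loopless h)) (∧-zeroʳ e))
    where e = does (g ≟ proj₁ (coord G H y))
  ... | no  _    = contradiction ly λ ()

  sameNb-□ : ∀ y → sameNb (G □ H) side′ x y ≡ layer (sameNb G side g) y ∨ fibre y
  sameNb-□ y = begin
    closedNb (G □ H) x y ∧ s                ≡⟨ cong (_∧ s) (closedNb-□ y) ⟩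
    (layer (closedNb G g) y ∨ fibre y) ∧ s  ≡⟨ ∨-∧-distrib-⊆ _ (fibre y) s (fibre⊆samePart y) ⟩
    (layer (closedNb G g) y ∧ s) ∨ fibre y
      ≡⟨ cong (_∨ fibre y) (∧-assoc (does (h ≟ hy)) (closedNb G g gy) s) ⟩
    layer (sameNb G side g) y ∨ fibre y     ∎
    where
    open ≡-Reasoning
    gy = proj₁ (coord G H y)
    hy = proj₂ (coord G H y)
    s  = sameSide (side gy) (side g)

  crossNb-□ : ∀ y → crossNb (G □ H) side′ x y ≡ layer (crossNb G side g) y
  crossNb-□ y = begin
    closedNb (G □ H) x y ∧ not s                ≡⟨ cong (_∧ not s) (closedNb-□ y) ⟩
    (layer (closedNb G g) y ∨ fibre y) ∧ not s  ≡⟨ ∨-∧-not-⊆ _ (fibre y) s (fibre⊆samePart y) ⟩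
    layer (closedNb G g) y ∧ not s              ≡⟨ ∧-assoc (does (h ≟ hy)) (closedNb G g gy) (not s) ⟩
    layer (crossNb G side g) y                  ∎
    where
    open ≡-Reasoning
    gy = proj₁ (coord G H y)
    hy = proj₂ (coord G H y)
    s  = sameSide (side gy) (side g)

  sameCount-□ : (∀ v → adj H v v ≡ false) →
                sameCount (G □ H) side′ x ≡ sameCount G side g + count (n (G □ H)) fibre
  sameCount-□ loopless = begin
    sameCount (G □ H) side′ x                           ≡⟨ count-cong sameNb-□ ⟩
    count _ (λ y → layer (sameNb G side g) y ∨ fibre y)
      ≡⟨ count-∨ _ fibre (layer∩fibre loopless (sameNb G side g)) ⟩
    count _ (layer (sameNb G side g)) + count _ fibre
      ≡⟨ cong (_+ count _ fibre) (count-layer (n G) h (sameNb G side g)) ⟩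
    sameCount G side g + count _ fibre                  ∎
    where open ≡-Reasoning

  crossCount-□ : crossCount (G □ H) side′ x ≡ crossCount G side g
  crossCount-□ = trans (count-cong crossNb-□) (count-layer (n G) h (crossNb G side g))

  closedDeg-□ : closedDeg (G □ H) x ≡ sameCount (G □ H) side′ x + crossCount G side g
  closedDeg-□ = trans (closedDeg-split (G □ H) side′ x)
                      (cong (sameCount (G □ H) side′ x +_) crossCount-□)

  fibre-nonempty : Connected H → 2 ≤ n H → 0 ℕ.< count (n (G □ H)) fibre
  fibre-nonempty conn 2≤n with connected⇒neighbour conn 2≤n h
  ... | h′ , hh′ = count-pos fibre (combine g h′)
    (subst (λ (g′ , h″) → does (g ≟ g′) ∧ adj H h h″ ≡ true) (sym (remQuot-combine g h′))
           (cong₂ _∧_ (dec-true (g ≟ g) refl) hh′))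

  module _ (loopless : ∀ v → adj H v v ≡ false) (conn : Connected H) (2≤n : 2 ≤ n H) where

    sameCount-< : sameCount G side g ℕ.< sameCount (G □ H) side′ x
    sameCount-< = subst (sameCount G side g ℕ.<_) (sym (sameCount-□ loopless))
                        (ℕ.m<m+n _ (fibre-nonempty conn 2≤n))

    q<q-□ : 0 ℕ.< crossCount G side g → q G side g < q (G □ H) side′ x
    q<q-□ 0<c = q<q G side g (G □ H) side′ x
      (subst₂ (λ D d → sameCount G side g * D ℕ.< sameCount (G □ H) side′ x * d)
              (sym closedDeg-□) (sym (closedDeg-split G side g))
              (a*[A+c]<A*[a+c] (crossCount G side g) sameCount-< 0<c))

    q<q-□-interior : crossCount G side g ≡ 0 → ∀ w → 0 ℕ.< crossCount G side w →
                     q G side w < q (G □ H) side′ x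
    q<q-□-interior c≡0 w 0<cw = q<q G side w (G □ H) side′ x
      (subst₂ (λ D d → sameCount G side w * D ℕ.< sameCount (G □ H) side′ x * d)
              (sym closedDeg≡sameCount) (sym (closedDeg-split G side w))
              (a*A<A*[a+c] (ℕ.≤-trans (s≤s z≤n) sameCount-<) 0<cw))
      where
      closedDeg≡sameCount : closedDeg (G □ H) x ≡ sameCount (G □ H) side′ x
      closedDeg≡sameCount = trans closedDeg-□
        (trans (cong (sameCount (G □ H) side′ x +_) c≡0) (ℕ.+-identityʳ _))

lemma4 : (G H : Graph) → IsSimple G → IsSimple H → Connected G → Connected H →
         2 ≤ n G → 2 ≤ n H →
         (side : Fin (n G) → Bool) → IsPartition G side →
         (b : Bool) → (m m' : ℚ) →
         IsMinOn side b (q G side) m →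
         IsMinOn (liftSide G H side) b (q (G □ H) (liftSide G H side)) m' →
         m < m'
lemma4 G H _ (_ , loopless) connG connH _ 2≤nH side partition b m m′
       (_ , m≤q) ((x , x∈b , q′x≡m′) , _) = subst (m <_) q′x≡m′ m<q′x
  where
  open ProductVertex G H side x
  m<q′x : m < q (G □ H) side′ x
  m<q′x with crossCount G side g in c≡
  ... | suc _ = ≤-<-trans (m≤q g x∈b) (q<q-□ loopless connH 2≤nH (subst (0 ℕ.<_) (sym c≡) z<s))
  ... | zero  with connected⇒exitEdge connG partition b
  ...   | exit@(w , _ , w∈b , _) =
    ≤-<-trans (m≤q w w∈b) (q<q-□-interior loopless connH 2≤nH c≡ w (exitEdge⇒crossCount-pos exit))
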